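{- Let $p$ be a prime, let $a,b\in\mathbb{Z}$ with $a>0$, $b>0$, $\gcd(a,b)=1$, and let $k\in\mathbb{Z}$ with $k\le -\operatorname{ord}_p(a/b)$. Run the $p^k$-Greedy Algorithm on $a/b$, producing quotients $q_0,q_1,\dots$, and suppose no jump occurs in any of its division steps. Let $q'_0,q'_1,\dots$ be the quotients produced by the Fibonacci–Sylvester Greedy Algorithm on the rational number $ap^k/b$. Then each term $1/q_i$ of the $p^k$-Greedy expansion of $a/b$ equals the corresponding term $1/q'_i$ of the Fibonacci–Sylvester Greedy expansion of $ap^k/b$ divided by $p^k$, i.e. $q_i=p^kq'_i$.
   Context: $\operatorname{ord}_p$ is the $p$-adic valuation and $|\cdot|_p$ the $p$-adic absolute value. For $x\in\mathbb{Q}_p^\times$, its unit part is $\hat x=xp^{ -\operatorname{ord}_p(x)}$. $p^k$-division algorithm: for $a',b'\in\mathbb{Z}[\tfrac1p]$, $a'>0$, there are unique $q,r\in\mathbb{Z}[\tfrac1p]$ with $b'=a'q-r$, $0\le r<a'p^k$, $|r|_p\le|a'p^k|_p$. In this division, let $\bar r$ be the integer with $0\le\bar r<\hat{a'}$ and $\bar r\equiv -\hat{b'}\,p^{\operatorname{ord}_p(b')-\operatorname{ord}_p(a')-k}\pmod{\hat{a'}}$ (powers of $p$ make sense mod $\hat{a'}$ since $p\nmid\hat{a'}$); one says a jump occurs in this division if $\operatorname{ord}_p(\bar r)\ge 1$. $p^k$-Greedy Algorithm on $a/b$: set $r_{ -1}=a$; for $i\ge0$ while $r_{i-1}\neq0$,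 let $q_i,r_i$ be the quotient and remainder of the $p^k$-division algorithm with divisor $r_{i-1}$ and dividend $bq_0\cdots q_{i-1}$ (dividend $b$ when $i=0$), i.e. $bq_0\cdots q_{i-1}=r_{i-1}q_i-r_i$; stop when $r_N=0$. Fibonacci–Sylvester Greedy Algorithm on a rational $x>-1$: write $x=a'/b'$ with $a',b'\in\mathbb{Z}$, $a'>0$, $\gcd(a',b')=1$; set $r_{ -1}=a'$ and for $i\ge0$ while $r_{i-1}\neq 0$ let $q'_i,r_i\in\mathbb{Z}$ be the unique integers with $b'q'_0\cdots q'_{i-1}=r_{i-1}q'_i-r_i$ and $0\le r_i<r_{i-1}$; stop when $r_N=0$. -}

module Defs where

open import Data.Nat as ℕ using (ℕ; zero; suc)
open import Data.Nat.Properties as ℕP using (m^n≢0)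
open import Data.Nat.Primality using (Prime; prime⇒nonZero)
import Data.Nat.Divisibility as ℕD
open import Data.Integer as ℤ using (ℤ; +_; -[1+_])
import Data.Integer.Divisibility as ℤD
open import Data.Rational as ℚ using (ℚ; ↥_; ↧ₙ_; 0ℚ; 1ℚ; _/_)
open import Data.Product using (Σ; _×_)
open import Data.Sum using (_⊎_)
open import Relation.Nullary using (¬_)
open import Relation.Binary.PropositionalEquality using (_≡_; _≢_)

ℤtoℚ : ℤ → ℚ
ℤtoℚ m = m / 1

pPow : (p : ℕ) → Prime p → ℤ → ℚ
pPow p pp (+ n)    = ℤtoℚ (+ (p ℕ.^ n))
pPow p pp -[1+ n ] = _/_ (+ 1) (p ℕ.^ suc n)
  {{ m^n≢0 p (suc n) {{prime⇒nonZero pp}} }}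

IsPUnit : ℕ → ℚ → Set
IsPUnit p u = ¬ (p ℕD.∣ ℤ.∣ ↥ u ∣) × ¬ (p ℕD.∣ ↧ₙ u)

-- OrdUnit p pp x v u :  ord_p(x) = v and the unit part x p^{-v} of x is u.
-- (Forces x ≠ 0, since a unit u is nonzero.)
OrdUnit : (p : ℕ) → Prime p → ℚ → ℤ → ℚ → Set
OrdUnit p pp x v u = IsPUnit p u × x ≡ pPow p pp v ℚ.* u

Ord : (p : ℕ) → Prime p → ℚ → ℤ → Set
Ord p pp x v = Σ ℚ λ u → OrdUnit p pp x v u

InZ1/p : (p : ℕ) → Prime p → ℚ → Set
InZ1/p p pp x = Σ ℤ λ m → Σ ℤ λ e → x ≡ ℤtoℚ m ℚ.* pPow p pp e

-- |r|_p ≤ |s|_p   (|0|_p = 0)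
AbsPLe : (p : ℕ) → Prime p → ℚ → ℚ → Set
AbsPLe p pp r s = r ≡ 0ℚ ⊎ (∀ v w → Ord p pp r v → Ord p pp s w → w ℤ.≤ v)

PkDivision : (p : ℕ) → Prime p → (k : ℤ) → (a' b' q r : ℚ) → Set
PkDivision p pp k a' b' q r =
  InZ1/p p pp q × InZ1/p p pp r ×
  b' ≡ a' ℚ.* q ℚ.- r ×
  0ℚ ℚ.≤ r × r ℚ.< a' ℚ.* pPow p pp k ×
  AbsPLe p pp r (a' ℚ.* pPow p pp k)

-- "rbar ≡ - ub * p^e (mod ua)" for e ∈ ℤ (p^e is taken mod ua, p ∤ ua):
-- for e = -n < 0 this is rbar * p^n ≡ - ub (mod ua).
CongrPow : ℕ → (ua ub : ℤ) → (e : ℤ) → (rbar : ℕ) → Set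
CongrPow p ua ub (+ n)    rbar = ua ℤD.∣ (+ rbar ℤ.+ ub ℤ.* + (p ℕ.^ n))
CongrPow p ua ub -[1+ n ] rbar = ua ℤD.∣ (+ rbar ℤ.* + (p ℕ.^ suc n) ℤ.+ ub)

-- A jump occurs in the p^k-division with divisor a' and dividend b':
-- rbar (the integer with 0 ≤ rbar < â', rbar ≡ -b̂' p^(ord b' - ord a' - k) mod â')
-- satisfies ord_p(rbar) ≥ 1, read as: rbar ≠ 0 and p ∣ rbar.
Jump : (p : ℕ) → Prime p → (k : ℤ) → (a' b' : ℚ) → Set
Jump p pp k a' b' =
  Σ ℤ λ w → Σ ℚ λ ua → Σ ℤ λ v → Σ ℚ λ ub → Σ ℕ λ rbar →
    OrdUnit p pp a' w ua × OrdUnit p pp b' v ub ×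
    ℤ.+ rbar ℤ.< ↥ ua ×
    CongrPow p (↥ ua) (↥ ub) (v ℤ.- w ℤ.- k) rbar ×
    rbar ≢ 0 × p ℕD.∣ rbar

prodℚ : (ℕ → ℚ) → ℕ → ℚ
prodℚ f zero    = 1ℚ
prodℚ f (suc i) = prodℚ f i ℚ.* f i

prodℤ : (ℕ → ℤ) → ℕ → ℤ
prodℤ f zero    = + 1
prodℤ f (suc i) = prodℤ f i ℤ.* f i

-- Indexing: R i = r_{i-1} (so R 0 = a), Q i = q_i.  While R i ≠ 0, step i is the
-- p^k-division with divisor R i and dividend b q_0 ⋯ q_{i-1}; once some R i = 0 the
-- algorithm has stopped (remainders stay 0 and Q is unconstrained from there on).
PkGreedyRun : (p : ℕ) → Prime p → (k : ℤ) → (a b : ℤ) → (Q R : ℕ → ℚ) → Set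
PkGreedyRun p pp k a b Q R =
  R 0 ≡ ℤtoℚ a ×
  (∀ i → (R i ≢ 0ℚ → PkDivision p pp k (R i) (ℤtoℚ b ℚ.* prodℚ Q i) (Q i) (R (suc i)))
       × (R i ≡ 0ℚ → R (suc i) ≡ 0ℚ))

NoJumps : (p : ℕ) → Prime p → (k : ℤ) → (b : ℤ) → (Q R : ℕ → ℚ) → Set
NoJumps p pp k b Q R =
  ∀ i → R i ≢ 0ℚ → ¬ Jump p pp k (R i) (ℤtoℚ b ℚ.* prodℚ Q i)

-- A run of the Fibonacci–Sylvester Greedy Algorithm on a'/b' (a' > 0, gcd(a',b') = 1).
-- Same indexing: R i = r_{i-1}, R 0 = a'.
FSGreedyRun : (a' b' : ℤ) → (Q R : ℕ → ℤ) → Set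
FSGreedyRun a' b' Q R =
  R 0 ≡ a' ×
  (∀ i → (R i ≢ + 0 → b' ℤ.* prodℤ Q i ≡ R i ℤ.* Q i ℤ.- R (suc i)
                       × + 0 ℤ.≤ R (suc i) × R (suc i) ℤ.< R i)
       × (R i ≡ + 0 → R (suc i) ≡ + 0))

module Submission where

-- Normal form: writing a = p^α â (p ∤ â), the hypothesis k ≤ -ord_p(a/b) forces
-- a' = â and b = p^(α+k) b' with b' = b̂ p^n, n ≥ 0 (`normal-form`).
-- Alignment, by induction on i: r_(i-1) = p^(α+ik) r'_(i-1) and
-- q_0⋯q_(i-1) = p^(ik) q'_0⋯q'_(i-1), where r'_(i-1) is 0 or prime to p.  In step i
-- the p^k-division has divisor p^w c and dividend p^(w+k) N with c = r'_(i-1) and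
-- N = b' q'_0⋯q'_(i-1) ∈ ℤ; such a division is the Euclidean division N = c y - s
-- rescaled by powers of p (`pkDivision-rescaled`, resting on two integrality facts
-- about ℤ[1/p]), so `euclid-unique` gives y = q'_i and s = r'_i, while a nonzero s
-- divisible by p would be a jump (`jump-of-rescaled`).

open import Defs
open import Data.Nat using (ℕ)
open import Data.Nat.Primality using (Prime)
open import Data.Integer as ℤ using (ℤ; +_; -_)
open import Data.Integer.GCD using (gcd)
open import Data.Rational as ℚ using (ℚ; 0ℚ)
open import Data.Product using (_×_)
open import Relation.Binary.PropositionalEquality using (_≡_; _≢_)

open import Data.Nat as ℕ using (zero; suc)
import Data.Nat.Properties as ℕP
import Data.Nat.GCD as ℕGCD
open import Data.Nat.Primality using (prime⇒nonZero; prime⇒irreducible; prime⇒nonTrivial)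
open import Data.Nat.Divisibility as ℕD using (divides; _∣?_)
open import Data.Nat.Coprimality as Cop using (Coprime)
open import Data.Integer using (-[1+_]; ∣_∣)
import Data.Integer.Properties as ℤP
import Data.Integer.Divisibility.Signed as ℤS
open import Data.Rational using (1ℚ; ↥_; ↧_; mkℚ; _/_)
import Data.Rational.Properties as ℚP
import Data.Rational.Unnormalised as U
import Data.Rational.Unnormalised.Properties as UP
open import Data.Product using (Σ; _,_; proj₁; proj₂)
open import Data.Sum using (_⊎_; inj₁; inj₂; [_,_]′)
open import Data.Empty using (⊥-elim)
open import Relation.Nullary using (¬_; yes; no)
open import Relation.Binary.PropositionalEquality
  using (refl; sym; trans; cong; cong₂; subst; subst₂; module ≡-Reasoning)
open import Data.Rational.Solver using (module +-*-Solver)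
open +-*-Solver
import Data.Integer.Solver as ℤSolver
module ℤR = ℤSolver.+-*-Solver

gcd[m,1]≡1 : ∀ m → gcd m (+ 1) ≡ + 1
gcd[m,1]≡1 m = cong +_ (ℕD.∣1⇒≡1 (ℕGCD.gcd[m,n]∣n ∣ m ∣ 1))

↥-ℤtoℚ : ∀ m → ↥ (ℤtoℚ m) ≡ m
↥-ℤtoℚ m = trans (sym (ℤP.*-identityʳ _))
  (trans (cong (↥ (ℤtoℚ m) ℤ.*_) (sym (gcd[m,1]≡1 m))) (ℚP.↥-/ m 1))

↧-ℤtoℚ : ∀ m → ↧ (ℤtoℚ m) ≡ + 1
↧-ℤtoℚ m = trans (sym (ℤP.*-identityʳ _))
  (trans (cong (↧ (ℤtoℚ m) ℤ.*_) (sym (gcd[m,1]≡1 m))) (ℚP.↧-/ m 1))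

ℤtoℚ-injective : ∀ {m n} → ℤtoℚ m ≡ ℤtoℚ n → m ≡ n
ℤtoℚ-injective {m} {n} eq = trans (sym (↥-ℤtoℚ m)) (trans (cong ↥_ eq) (↥-ℤtoℚ n))

cross : ∀ m n → ↥ (ℤtoℚ m) ℤ.* ↧ (ℤtoℚ n) ≡ m
cross m n = trans (cong₂ ℤ._*_ (↥-ℤtoℚ m) (↧-ℤtoℚ n)) (ℤP.*-identityʳ m)

ℤtoℚ-mono-< : ∀ {m n} → m ℤ.< n → ℤtoℚ m ℚ.< ℤtoℚ n
ℤtoℚ-mono-< {m} {n} m<n = ℚ.*<* (subst₂ ℤ._<_ (sym (cross m n)) (sym (cross n m)) m<n)

ℤtoℚ-cancel-< : ∀ {m n} → ℤtoℚ m ℚ.< ℤtoℚ n → m ℤ.< n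
ℤtoℚ-cancel-< {m} {n} (ℚ.*<* m<n) = subst₂ ℤ._<_ (cross m n) (cross n m) m<n

ℤtoℚ-cancel-≤ : ∀ {m n} → ℤtoℚ m ℚ.≤ ℤtoℚ n → m ℤ.≤ n
ℤtoℚ-cancel-≤ {m} {n} (ℚ.*≤* m≤n) = subst₂ ℤ._≤_ (cross m n) (cross n m) m≤n

toℚᵘ-ℤtoℚ : ∀ m → ℚ.toℚᵘ (ℤtoℚ m) U.≃ U.mkℚᵘ m 0
toℚᵘ-ℤtoℚ m = ℚP.toℚᵘ-fromℚᵘ (U.mkℚᵘ m 0)

ℤtoℚ-* : ∀ m n → ℤtoℚ (m ℤ.* n) ≡ ℤtoℚ m ℚ.* ℤtoℚ n
ℤtoℚ-* m n = ℚP.toℚᵘ-injective (UP.≃-trans (toℚᵘ-ℤtoℚ (m ℤ.* n))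
  (UP.≃-sym (UP.≃-trans (ℚP.toℚᵘ-homo-* (ℤtoℚ m) (ℤtoℚ n))
                        (UP.*-cong (toℚᵘ-ℤtoℚ m) (toℚᵘ-ℤtoℚ n)))))

ℤtoℚ-+ : ∀ m n → ℤtoℚ (m ℤ.+ n) ≡ ℤtoℚ m ℚ.+ ℤtoℚ n
ℤtoℚ-+ m n = ℚP.toℚᵘ-injective (UP.≃-trans (toℚᵘ-ℤtoℚ (m ℤ.+ n))
  (UP.≃-sym (UP.≃-trans (ℚP.toℚᵘ-homo-+ (ℤtoℚ m) (ℤtoℚ n))
    (UP.≃-trans (UP.+-cong (toℚᵘ-ℤtoℚ m) (toℚᵘ-ℤtoℚ n))
      (U.*≡* (cong (ℤ._* + 1) (cong₂ ℤ._+_ (ℤP.*-identityʳ m) (ℤP.*-identityʳ n))))))))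

*-cancelʳ-pos : ∀ {x y} c → 0ℚ ℚ.< c → x ℚ.* c ≡ y ℚ.* c → x ≡ y
*-cancelʳ-pos c 0<c eq = ℚP.≤-antisym (ℚP.*-cancelʳ-≤-pos c (ℚP.≤-reflexive eq))
                                      (ℚP.*-cancelʳ-≤-pos c (ℚP.≤-reflexive (sym eq)))
  where instance _ = ℚ.positive 0<c

*-interchange : ∀ w x y z → (w ℚ.* x) ℚ.* (y ℚ.* z) ≡ (w ℚ.* y) ℚ.* (x ℚ.* z)
*-interchange = solve 4 (λ w x y z → (w :* x) :* (y :* z) := (w :* y) :* (x :* z)) refl

1/d-inverse : ∀ d .{{_ : ℕ.NonZero d}} → (+ 1 / d) ℚ.* ℤtoℚ (+ d) ≡ 1ℚ
1/d-inverse (suc d) = ℚP.toℚᵘ-injective (UP.≃-trans (ℚP.toℚᵘ-homo-* (+ 1 / suc d) (ℤtoℚ (+ suc d)))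
  (UP.≃-trans (UP.*-cong (ℚP.toℚᵘ-fromℚᵘ (U.mkℚᵘ (+ 1) d)) (toℚᵘ-ℤtoℚ (+ suc d))) (U.*≡* cross-product)))
  where
  cross-product : (+ 1 ℤ.* + suc d) ℤ.* + 1 ≡ + 1 ℤ.* (+ suc (d ℕ.* 1))
  cross-product rewrite ℕP.*-identityʳ d = ℤP.*-identityʳ _

mkℚ-*-denominator : ∀ n d .(c : Coprime ∣ n ∣ (suc d)) → mkℚ n d c ℚ.* ℤtoℚ (+ suc d) ≡ ℤtoℚ n
mkℚ-*-denominator n d c = ℚP.toℚᵘ-injective (UP.≃-trans (ℚP.toℚᵘ-homo-* (mkℚ n d c) (ℤtoℚ (+ suc d)))
  (UP.≃-trans (UP.*-congˡ {U.mkℚᵘ n d} (toℚᵘ-ℤtoℚ (+ suc d))) (UP.≃-trans (U.*≡* cross-product) (UP.≃-sym (toℚᵘ-ℤtoℚ n)))))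
  where
  cross-product : (n ℤ.* + suc d) ℤ.* + 1 ≡ n ℤ.* + suc (d ℕ.* 1)
  cross-product rewrite ℕP.*-identityʳ d = ℤP.*-identityʳ _

asDifference : ∀ e → Σ ℕ λ m → Σ ℕ λ n → e ≡ + m ℤ.- + n
asDifference (+ m)    = m , 0 , sym (ℤP.+-identityʳ (+ m))
asDifference -[1+ n ] = 0 , suc n , refl

*-pos : ∀ {x y} → + 0 ℤ.< x → + 0 ℤ.< y → + 0 ℤ.< x ℤ.* y
*-pos {x} {y} 0<x 0<y = subst (ℤ._< x ℤ.* y) (ℤP.*-zeroʳ x) (ℤP.*-monoˡ-<-pos x {{ℤ.positive 0<x}} 0<y)

-- Uniqueness of Euclidean division: c y - s = c q - r with 0 ≤ s, r < c forces
-- y = q, since c (y - q) = s - r lies strictly between -c and c.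
euclid-unique : ∀ {c y s q r} → + 0 ℤ.< c → c ℤ.* y ℤ.- s ≡ c ℤ.* q ℤ.- r →
                + 0 ℤ.≤ s → s ℤ.< c → + 0 ℤ.≤ r → r ℤ.< c → y ≡ q
euclid-unique {c} {y} {s} {q} {r} 0<c eq 0≤s s<c 0≤r r<c = by-difference (y ℤ.- q) refl
  where
  instance
    r-nonNeg = ℤ.nonNegative 0≤r
    s-nonNeg = ℤ.nonNegative 0≤s
    c-nonNeg = ℤ.nonNegative (ℤP.<⇒≤ 0<c)
  c[y-q]≡s-r : c ℤ.* (y ℤ.- q) ≡ s ℤ.- r
  c[y-q]≡s-r = begin
    c ℤ.* (y ℤ.- q)                                        ≡⟨ ℤR.solve 5 (λ c y s q r → c ℤR.:* (y ℤR.:- q) ℤR.:= ((c ℤR.:* y ℤR.:- s) ℤR.:- (c ℤR.:* q ℤR.:- r)) ℤR.:+ (s ℤR.:- r)) refl c y s q r ⟩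
    ((c ℤ.* y ℤ.- s) ℤ.- (c ℤ.* q ℤ.- r)) ℤ.+ (s ℤ.- r)   ≡⟨ cong (λ z → (z ℤ.- (c ℤ.* q ℤ.- r)) ℤ.+ (s ℤ.- r)) eq ⟩
    ((c ℤ.* q ℤ.- r) ℤ.- (c ℤ.* q ℤ.- r)) ℤ.+ (s ℤ.- r)   ≡⟨ ℤR.solve 2 (λ x z → (x ℤR.:- x) ℤR.:+ z ℤR.:= z) refl (c ℤ.* q ℤ.- r) (s ℤ.- r) ⟩
    s ℤ.- r                                                ∎
    where open ≡-Reasoning
  by-difference : ∀ d → y ℤ.- q ≡ d → y ≡ q
  by-difference (+ zero) y-q≡0 = trans (ℤR.solve 2 (λ y q → y ℤR.:= (y ℤR.:- q) ℤR.:+ q) refl y q)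
                                       (trans (cong (ℤ._+ q) y-q≡0) (ℤP.+-identityˡ q))
  by-difference (+ suc n) y-q≡d = ⊥-elim (ℤP.<⇒≱ below above)
    where
    above : c ℤ.≤ c ℤ.* (y ℤ.- q)
    above = subst₂ ℤ._≤_ (ℤP.*-identityʳ c) (cong (c ℤ.*_) (sym y-q≡d)) (ℤP.*-monoˡ-≤-nonNeg c (ℤ.+≤+ (ℕ.s≤s ℕ.z≤n)))
    below : c ℤ.* (y ℤ.- q) ℤ.< c
    below = subst (ℤ._< c) (sym c[y-q]≡s-r) (ℤP.≤-<-trans (ℤP.i-j≤i s r) s<c)
  by-difference -[1+ n ] y-q≡d = ⊥-elim (ℤP.<⇒≱ above below)
    where
    below : c ℤ.* (y ℤ.- q) ℤ.≤ - c
    below = subst₂ ℤ._≤_ (cong (c ℤ.*_) (sym y-q≡d)) (trans (ℤP.*-comm c (ℤ.-[1+ 0 ])) (ℤP.-1*i≡-i c))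
                  (ℤP.*-monoˡ-≤-nonNeg c (ℤ.-≤- ℕ.z≤n))
    above : - c ℤ.< c ℤ.* (y ℤ.- q)
    above = subst (- c ℤ.<_) (trans (ℤP.+-comm (- r) s) (sym c[y-q]≡s-r))
                  (ℤP.<-≤-trans (ℤP.neg-mono-< r<c) (ℤP.i≤i+j (- r) s))

module _ (p : ℕ) (pp : Prime p) where
  private
    pw : ℤ → ℚ
    pw = pPow p pp
    instance
      p≢0 : ℕ.NonZero p
      p≢0 = prime⇒nonZero pp

  p^n>0 : ∀ n → 0 ℕ.< p ℕ.^ n
  p^n>0 n = ℕ.>-nonZero⁻¹ (p ℕ.^ n) {{ℕP.m^n≢0 p n}}

  pPow-pos : ∀ e → 0ℚ ℚ.< pw e
  pPow-pos (+ n)    = ℤtoℚ-mono-< (ℤ.+<+ (p^n>0 n))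
  pPow-pos -[1+ n ] = ℚP.positive⁻¹ _ {{ℚP.normalize-pos 1 (p ℕ.^ suc n) {{ℕP.m^n≢0 p (suc n)}}}}

  pPow-+ℕ : ∀ m n → pw (+ (m ℕ.+ n)) ≡ pw (+ m) ℚ.* pw (+ n)
  pPow-+ℕ m n = trans (cong (λ z → ℤtoℚ (+ z)) (ℕP.^-distribˡ-+-* p m n))
                      (trans (cong ℤtoℚ (ℤP.pos-* (p ℕ.^ m) (p ℕ.^ n))) (ℤtoℚ-* (+ (p ℕ.^ m)) (+ (p ℕ.^ n))))

  pPow-diff : ∀ m n → pw (+ m ℤ.- + n) ℚ.* pw (+ n) ≡ pw (+ m)
  pPow-diff m       zero    = trans (cong (λ z → pw z ℚ.* 1ℚ) (ℤP.+-identityʳ (+ m))) (ℚP.*-identityʳ _)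
  pPow-diff zero    (suc n) = 1/d-inverse (p ℕ.^ suc n) {{ℕP.m^n≢0 p (suc n)}}
  pPow-diff (suc m) (suc n) = begin
    pw (+ suc m ℤ.- + suc n) ℚ.* pw (+ suc n)         ≡⟨ cong₂ (λ e x → pw e ℚ.* x) exponent (pPow-+ℕ 1 n) ⟩
    pw (+ m ℤ.- + n) ℚ.* (pw (+ 1) ℚ.* pw (+ n))     ≡⟨ solve 3 (λ a b c → a :* (b :* c) := (a :* c) :* b) refl (pw (+ m ℤ.- + n)) (pw (+ 1)) (pw (+ n)) ⟩
    (pw (+ m ℤ.- + n) ℚ.* pw (+ n)) ℚ.* pw (+ 1)     ≡⟨ cong (ℚ._* pw (+ 1)) (pPow-diff m n) ⟩
    pw (+ m) ℚ.* pw (+ 1)                             ≡⟨ sym (trans (cong (λ z → pw (+ z)) (ℕP.+-comm 1 m)) (pPow-+ℕ m 1)) ⟩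
    pw (+ suc m)                                      ∎
    where
    open ≡-Reasoning
    exponent : + suc m ℤ.- + suc n ≡ + m ℤ.- + n
    exponent = trans (ℤP.m-n≡m⊖n (suc m) (suc n)) (trans (ℤP.[1+m]⊖[1+n]≡m⊖n m n) (sym (ℤP.m-n≡m⊖n m n)))

  -- The exponent law, reduced to pPow-diff by writing e and f as differences.
  pPow-+ : ∀ e f → pw (e ℤ.+ f) ≡ pw e ℚ.* pw f
  pPow-+ e f with asDifference e | asDifference f
  ... | m₁ , n₁ , refl | m₂ , n₂ , refl =
    *-cancelʳ-pos (pw (+ (n₁ ℕ.+ n₂))) (pPow-pos (+ (n₁ ℕ.+ n₂))) (begin
      pw ((+ m₁ ℤ.- + n₁) ℤ.+ (+ m₂ ℤ.- + n₂)) ℚ.* pw (+ (n₁ ℕ.+ n₂))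
        ≡⟨ cong (λ z → pw z ℚ.* pw (+ (n₁ ℕ.+ n₂))) regroup ⟩
      pw (+ (m₁ ℕ.+ m₂) ℤ.- + (n₁ ℕ.+ n₂)) ℚ.* pw (+ (n₁ ℕ.+ n₂))
        ≡⟨ pPow-diff (m₁ ℕ.+ m₂) (n₁ ℕ.+ n₂) ⟩
      pw (+ (m₁ ℕ.+ m₂))
        ≡⟨ pPow-+ℕ m₁ m₂ ⟩
      pw (+ m₁) ℚ.* pw (+ m₂)
        ≡⟨ sym (cong₂ ℚ._*_ (pPow-diff m₁ n₁) (pPow-diff m₂ n₂)) ⟩
      (pw (+ m₁ ℤ.- + n₁) ℚ.* pw (+ n₁)) ℚ.* (pw (+ m₂ ℤ.- + n₂) ℚ.* pw (+ n₂))
        ≡⟨ *-interchange (pw (+ m₁ ℤ.- + n₁)) (pw (+ n₁)) (pw (+ m₂ ℤ.- + n₂)) (pw (+ n₂)) ⟩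
      (pw (+ m₁ ℤ.- + n₁) ℚ.* pw (+ m₂ ℤ.- + n₂)) ℚ.* (pw (+ n₁) ℚ.* pw (+ n₂))
        ≡⟨ cong ((pw (+ m₁ ℤ.- + n₁) ℚ.* pw (+ m₂ ℤ.- + n₂)) ℚ.*_) (sym (pPow-+ℕ n₁ n₂)) ⟩
      (pw (+ m₁ ℤ.- + n₁) ℚ.* pw (+ m₂ ℤ.- + n₂)) ℚ.* pw (+ (n₁ ℕ.+ n₂)) ∎)
    where
    open ≡-Reasoning
    regroup : (+ m₁ ℤ.- + n₁) ℤ.+ (+ m₂ ℤ.- + n₂) ≡ + (m₁ ℕ.+ m₂) ℤ.- + (n₁ ℕ.+ n₂)
    regroup rewrite ℤP.pos-+ m₁ m₂ | ℤP.pos-+ n₁ n₂ =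
      ℤR.solve 4 (λ a b c d → (a ℤR.:- b) ℤR.:+ (c ℤR.:- d) ℤR.:= (a ℤR.:+ c) ℤR.:- (b ℤR.:+ d)) refl
        (+ m₁) (+ n₁) (+ m₂) (+ n₂)

  p>1 : 1 ℕ.< p
  p>1 = ℕ.nonTrivial⇒n>1 p {{prime⇒nonTrivial pp}}

  -- Every n ≠ 0 is p^j u with p ∤ u.  Each division by p decreases n, so n
  -- itself bounds the number of recursive steps (the argument `fuel`).
  p-factorℕ : ∀ n → n ≢ 0 → Σ ℕ λ j → Σ ℕ λ u → n ≡ p ℕ.^ j ℕ.* u × ¬ (p ℕD.∣ u)
  p-factorℕ n = go n n ℕP.≤-refl
    where
    go : ∀ fuel n → n ℕ.≤ fuel → n ≢ 0 → Σ ℕ λ j → Σ ℕ λ u → n ≡ p ℕ.^ j ℕ.* u × ¬ (p ℕD.∣ u)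
    go fuel n n≤fuel n≢0 with p ∣? n
    ... | no p∤n = 0 , n , sym (ℕP.*-identityˡ n) , p∤n
    go zero n n≤0 n≢0 | yes _ = ⊥-elim (n≢0 (ℕP.n≤0⇒n≡0 n≤0))
    go (suc fuel) n n≤fuel n≢0 | yes (divides q n≡q*p)
      with go fuel q (ℕP.<⇒≤pred (ℕP.<-≤-trans q<n n≤fuel)) q≢0
      where
      q≢0 : q ≢ 0
      q≢0 refl = n≢0 n≡q*p
      q<n : q ℕ.< n
      q<n = subst (q ℕ.<_) (sym n≡q*p) (ℕP.m<m*n q p {{ℕ.≢-nonZero q≢0}} p>1)
    ... | j , u , q≡p^j*u , p∤u =
      suc j , u , trans n≡q*p (trans (cong (ℕ._* p) q≡p^j*u)
        (trans (ℕP.*-comm (p ℕ.^ j ℕ.* u) p) (sym (ℕP.*-assoc p (p ℕ.^ j) u)))) , p∤u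

  p-factorℤ : ∀ m → m ≢ + 0 → Σ ℕ λ j → Σ ℤ λ u → m ≡ + (p ℕ.^ j) ℤ.* u × ¬ (p ℕD.∣ ∣ u ∣)
  p-factorℤ (+ n) m≢0 with p-factorℕ n (λ n≡0 → m≢0 (cong +_ n≡0))
  ... | j , u , n≡ , p∤u = j , + u , trans (cong +_ n≡) (ℤP.pos-* (p ℕ.^ j) u) , p∤u
  p-factorℤ -[1+ n ] _ with p-factorℕ (suc n) (λ ())
  ... | j , u , n≡ , p∤u = j , - (+ u) ,
        trans (cong -_ (trans (cong +_ n≡) (ℤP.pos-* (p ℕ.^ j) u))) (ℤP.neg-distribʳ-* (+ (p ℕ.^ j)) (+ u)) ,
        subst (λ z → ¬ (p ℕD.∣ z)) (sym (ℤP.∣-i∣≡∣i∣ (+ u))) p∤u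

  isPUnit-ℤ : ∀ u → ¬ (p ℕD.∣ ∣ u ∣) → IsPUnit p (ℤtoℚ u)
  isPUnit-ℤ u p∤u = (λ p∣↥ → p∤u (subst (λ z → p ℕD.∣ ∣ z ∣) (↥-ℤtoℚ u) p∣↥)) ,
                    (λ p∣1 → ℕ.nonTrivial⇒≢1 {{prime⇒nonTrivial pp}}
                               (ℕD.∣1⇒≡1 (subst (p ℕD.∣_) (ℤP.+-injective (↧-ℤtoℚ u)) p∣1)))

  ordUnit-ℤ : ∀ e m → m ≢ + 0 → Σ ℕ λ j → Σ ℤ λ u → m ≡ + (p ℕ.^ j) ℤ.* u ×
                OrdUnit p pp (pw e ℚ.* ℤtoℚ m) (+ j ℤ.+ e) (ℤtoℚ u)
  ordUnit-ℤ e m m≢0 with p-factorℤ m m≢0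
  ... | j , u , m≡ , p∤u = j , u , m≡ , isPUnit-ℤ u p∤u , (begin
    pw e ℚ.* ℤtoℚ m                     ≡⟨ cong (λ z → pw e ℚ.* ℤtoℚ z) m≡ ⟩
    pw e ℚ.* ℤtoℚ (+ (p ℕ.^ j) ℤ.* u)   ≡⟨ cong (pw e ℚ.*_) (ℤtoℚ-* (+ (p ℕ.^ j)) u) ⟩
    pw e ℚ.* (pw (+ j) ℚ.* ℤtoℚ u)      ≡⟨ solve 3 (λ a b c → a :* (b :* c) := (b :* a) :* c) refl (pw e) (pw (+ j)) (ℤtoℚ u) ⟩
    (pw (+ j) ℚ.* pw e) ℚ.* ℤtoℚ u      ≡⟨ cong (ℚ._* ℤtoℚ u) (sym (pPow-+ (+ j) e)) ⟩
    pw (+ j ℤ.+ e) ℚ.* ℤtoℚ u           ∎)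
    where open ≡-Reasoning

  zero-unit-or-multiple : ∀ s → s ≡ 0 ⊎ ¬ (p ℕD.∣ s) ⊎ (s ≢ 0 × p ℕD.∣ s)
  zero-unit-or-multiple s with s ℕP.≟ 0 | p ∣? s
  ... | yes s≡0 | _       = inj₁ s≡0
  ... | no _    | no p∤s  = inj₂ (inj₁ p∤s)
  ... | no s≢0  | yes p∣s = inj₂ (inj₂ (s≢0 , p∣s))

  coprime-p : ∀ {c} → ¬ (p ℕD.∣ c) → Coprime c p
  coprime-p p∤c {d} (d∣c , d∣p) with prime⇒irreducible pp d∣p
  ... | inj₁ d≡1 = d≡1
  ... | inj₂ refl = ⊥-elim (p∤c d∣c)

  cancel-p^ : ∀ {c T} n → ¬ (p ℕD.∣ c) → c ℕD.∣ p ℕ.^ n ℕ.* T → c ℕD.∣ T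
  cancel-p^ {c} {T} zero    p∤c c∣T = subst (c ℕD.∣_) (ℕP.*-identityˡ T) c∣T
  cancel-p^ {c} {T} (suc n) p∤c c∣pT = cancel-p^ n p∤c
    (Cop.coprime-divisor (coprime-p p∤c) (subst (c ℕD.∣_) (ℕP.*-assoc p (p ℕ.^ n) T) c∣pT))

  -- If c x is an integer, c > 0 is prime to p and x ∈ ℤ[1/p], then x is an
  -- integer: clearing the denominator p^n of x gives c ∣ T p^n, hence c ∣ T.
  integral-of-multiple : ∀ {x} c T → 0 ℕ.< c → ¬ (p ℕD.∣ c) → InZ1/p p pp x →
                         ℤtoℚ (+ c) ℚ.* x ≡ ℤtoℚ T → Σ ℤ λ y → x ≡ ℤtoℚ y
  integral-of-multiple c T _   _   (m , + n , refl) _ = m ℤ.* + (p ℕ.^ n) , sym (ℤtoℚ-* m (+ (p ℕ.^ n)))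
  integral-of-multiple {x} c T c>0 p∤c (m , -[1+ n ] , refl) cx≡T = y , x≡y
    where
    N = p ℕ.^ suc n
    C = ℤtoℚ (+ c)
    cm≡TN : + c ℤ.* m ≡ T ℤ.* + N
    cm≡TN = ℤtoℚ-injective (begin
      ℤtoℚ (+ c ℤ.* m)                                     ≡⟨ ℤtoℚ-* (+ c) m ⟩
      C ℚ.* ℤtoℚ m                                         ≡⟨ sym (ℚP.*-identityʳ _) ⟩
      (C ℚ.* ℤtoℚ m) ℚ.* 1ℚ                                ≡⟨ cong ((C ℚ.* ℤtoℚ m) ℚ.*_) (sym (1/d-inverse N {{ℕP.m^n≢0 p (suc n)}})) ⟩
      (C ℚ.* ℤtoℚ m) ℚ.* (pw -[1+ n ] ℚ.* ℤtoℚ (+ N))      ≡⟨ solve 4 (λ a b c d → (a :* b) :* (c :* d) := (a :* (b :* c)) :* d) refl C (ℤtoℚ m) (pw -[1+ n ]) (ℤtoℚ (+ N)) ⟩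
      (C ℚ.* x) ℚ.* ℤtoℚ (+ N)                             ≡⟨ cong (ℚ._* ℤtoℚ (+ N)) cx≡T ⟩
      ℤtoℚ T ℚ.* ℤtoℚ (+ N)                                ≡⟨ sym (ℤtoℚ-* T (+ N)) ⟩
      ℤtoℚ (T ℤ.* + N)                                     ∎)
      where open ≡-Reasoning
    c∣TN : c ℕD.∣ ∣ T ℤ.* + N ∣
    c∣TN = subst (λ z → c ℕD.∣ ∣ z ∣) cm≡TN (subst (c ℕD.∣_) (sym (ℤP.abs-* (+ c) m)) (ℕD.∣m⇒∣m*n ∣ m ∣ ℕD.∣-refl))
    c∣T : ℤS._∣_ (+ c) T
    c∣T = ℤS.∣ᵤ⇒∣ (cancel-p^ (suc n) p∤c (subst (c ℕD.∣_) (trans (ℤP.abs-* T (+ N)) (ℕP.*-comm ∣ T ∣ N)) c∣TN))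
    y = ℤS._∣_.quotient c∣T
    x≡y : x ≡ ℤtoℚ y
    x≡y = *-cancelʳ-pos C (ℤtoℚ-mono-< (ℤ.+<+ c>0)) (begin
      x ℚ.* C         ≡⟨ ℚP.*-comm x C ⟩
      C ℚ.* x         ≡⟨ cx≡T ⟩
      ℤtoℚ T          ≡⟨ cong ℤtoℚ (ℤS._∣_.equality c∣T) ⟩
      ℤtoℚ (y ℤ.* + c) ≡⟨ ℤtoℚ-* y (+ c) ⟩
      ℤtoℚ y ℚ.* C    ∎)
      where open ≡-Reasoning

  natural-below : ∀ {r} w c z → r ≡ pw w ℚ.* ℤtoℚ z → 0ℚ ℚ.≤ r → r ℚ.< pw w ℚ.* ℤtoℚ (+ c) →
                  Σ ℕ λ s → r ≡ pw w ℚ.* ℤtoℚ (+ s) × s ℕ.< c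
  natural-below w c z refl 0≤r r<pwc =
    ∣ z ∣ , cong (λ t → pw w ℚ.* ℤtoℚ t) (sym ∣z∣≡z) , ℤP.drop‿+<+ (subst (ℤ._< + c) (sym ∣z∣≡z) z<c)
    where
    instance
      pw-positive = ℚ.positive (pPow-pos w)
      pw-nonNeg   = ℚP.pos⇒nonNeg (pw w)
    0≤z : + 0 ℤ.≤ z
    0≤z = ℤtoℚ-cancel-≤ (ℚP.*-cancelˡ-≤-pos (pw w) (subst (ℚ._≤ pw w ℚ.* ℤtoℚ z) (sym (ℚP.*-zeroʳ (pw w))) 0≤r))
    ∣z∣≡z : + ∣ z ∣ ≡ z
    ∣z∣≡z = ℤP.0≤i⇒+∣i∣≡i 0≤z
    z<c : z ℤ.< + c
    z<c = ℤtoℚ-cancel-< (ℚP.*-cancelˡ-<-nonNeg (pw w) r<pwc)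

  -- A p^k-remainder for the divisor p^w c (p ∤ c) has the form p^w s with s ∈ ℕ,
  -- s < c: the p-adic bound |r|_p ≤ |p^w c|_p = p^(-w) says ord_p(r) ≥ w.
  remainder-shape : ∀ {r} w c → ¬ (p ℕD.∣ c) → InZ1/p p pp r → AbsPLe p pp r (pw w ℚ.* ℤtoℚ (+ c)) →
                    0ℚ ℚ.≤ r → r ℚ.< pw w ℚ.* ℤtoℚ (+ c) →
                    Σ ℕ λ s → r ≡ pw w ℚ.* ℤtoℚ (+ s) × s ℕ.< c
  remainder-shape {r} w c p∤c (m , e , r≡) |r|≤ 0≤r r<pwc with m ℤP.≟ + 0 | |r|≤
  ... | yes refl | _      = natural-below w c (+ 0) (trans r≡ (trans (ℚP.*-zeroˡ (pw e)) (sym (ℚP.*-zeroʳ (pw w))))) 0≤r r<pwc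
  ... | no _     | inj₁ r≡0 = natural-below w c (+ 0) (trans r≡0 (sym (ℚP.*-zeroʳ (pw w)))) 0≤r r<pwc
  ... | no m≢0   | inj₂ ord≤ = natural-below w c (+ (p ℕ.^ t) ℤ.* u) r≡p^w* 0≤r r<pwc
    where
    factorisation = ordUnit-ℤ e m m≢0
    j = proj₁ factorisation
    u = proj₁ (proj₂ factorisation)
    ord-r = proj₂ (proj₂ (proj₂ factorisation))
    r≡pw*m : r ≡ pw e ℚ.* ℤtoℚ m
    r≡pw*m = trans r≡ (ℚP.*-comm (ℤtoℚ m) (pw e))
    w≤ord : w ℤ.≤ + j ℤ.+ e
    w≤ord = ord≤ (+ j ℤ.+ e) w (ℤtoℚ u , subst (λ x → OrdUnit p pp x (+ j ℤ.+ e) (ℤtoℚ u)) (sym r≡pw*m) ord-r)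
                                 (ℤtoℚ (+ c) , isPUnit-ℤ (+ c) p∤c , refl)
    t = ∣ (+ j ℤ.+ e) ℤ.- w ∣
    t≡ : + t ≡ (+ j ℤ.+ e) ℤ.- w
    t≡ = ℤP.0≤i⇒+∣i∣≡i (ℤP.i≤j⇒0≤j-i w≤ord)
    r≡p^w* : r ≡ pw w ℚ.* ℤtoℚ (+ (p ℕ.^ t) ℤ.* u)
    r≡p^w* = begin
      r                                      ≡⟨ trans r≡pw*m (proj₂ ord-r) ⟩
      pw (+ j ℤ.+ e) ℚ.* ℤtoℚ u              ≡⟨ cong (λ z → pw z ℚ.* ℤtoℚ u) (ℤR.solve 2 (λ a b → a ℤR.:= b ℤR.:+ (a ℤR.:- b)) refl (+ j ℤ.+ e) w) ⟩
      pw (w ℤ.+ ((+ j ℤ.+ e) ℤ.- w)) ℚ.* ℤtoℚ u ≡⟨ cong (λ z → pw (w ℤ.+ z) ℚ.* ℤtoℚ u) (sym t≡) ⟩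
      pw (w ℤ.+ + t) ℚ.* ℤtoℚ u              ≡⟨ cong (ℚ._* ℤtoℚ u) (pPow-+ w (+ t)) ⟩
      (pw w ℚ.* pw (+ t)) ℚ.* ℤtoℚ u         ≡⟨ ℚP.*-assoc (pw w) (pw (+ t)) (ℤtoℚ u) ⟩
      pw w ℚ.* (pw (+ t) ℚ.* ℤtoℚ u)         ≡⟨ cong (pw w ℚ.*_) (sym (ℤtoℚ-* (+ (p ℕ.^ t)) u)) ⟩
      pw w ℚ.* ℤtoℚ (+ (p ℕ.^ t) ℤ.* u)      ∎
      where open ≡-Reasoning

  record RescaledEuclid (k w : ℤ) (c : ℕ) (N : ℤ) (q r : ℚ) : Set where
    field
      y          : ℤ
      s          : ℕ
      s<c        : s ℕ.< c
      q≡p^k·y    : q ≡ pw k ℚ.* ℤtoℚ y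
      r≡p^wk·s   : r ≡ pw (w ℤ.+ k) ℚ.* ℤtoℚ (+ s)
      N≡cy-s     : + c ℤ.* y ℤ.- + s ≡ N

  -- The remainder has the shape p^(w+k) s by remainder-shape; then c · (q p^(-k)) = N + s
  -- shows q p^(-k) ∈ ℤ[1/p] is an integer y by integral-of-multiple.
  pkDivision-rescaled : ∀ k w c N {q r} → 0 ℕ.< c → ¬ (p ℕD.∣ c) →
                        PkDivision p pp k (pw w ℚ.* ℤtoℚ (+ c)) (pw (w ℤ.+ k) ℚ.* ℤtoℚ N) q r →
                        RescaledEuclid k w c N q r
  pkDivision-rescaled k w c N {q} {r} c>0 p∤c (q∈ℤ[1/p] , r∈ℤ[1/p] , N≡ , 0≤r , r<D , |r|≤D) = record
    { y = y ; s = s ; s<c = s<c ; q≡p^k·y = q≡ ; r≡p^wk·s = r≡ ; N≡cy-s = euclid }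
    where
    open ≡-Reasoning
    C = ℤtoℚ (+ c)
    E = pw (w ℤ.+ k)
    D*p^k≡E*C : (pw w ℚ.* C) ℚ.* pw k ≡ E ℚ.* C
    D*p^k≡E*C = trans (solve 3 (λ a b c → (a :* b) :* c := (a :* c) :* b) refl (pw w) C (pw k))
                      (cong (ℚ._* C) (sym (pPow-+ w k)))
    shape = remainder-shape (w ℤ.+ k) c p∤c r∈ℤ[1/p] (subst (AbsPLe p pp r) D*p^k≡E*C |r|≤D) 0≤r
                            (subst (r ℚ.<_) D*p^k≡E*C r<D)
    s = proj₁ shape
    r≡ = proj₁ (proj₂ shape)
    s<c = proj₂ (proj₂ shape)
    X = q ℚ.* pw (- k)
    X∈ℤ[1/p] : InZ1/p p pp X
    X∈ℤ[1/p] = m , e ℤ.+ - k , (begin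
      q ℚ.* pw (- k)                 ≡⟨ cong (ℚ._* pw (- k)) q≡ ⟩
      (ℤtoℚ m ℚ.* pw e) ℚ.* pw (- k) ≡⟨ ℚP.*-assoc (ℤtoℚ m) (pw e) (pw (- k)) ⟩
      ℤtoℚ m ℚ.* (pw e ℚ.* pw (- k)) ≡⟨ cong (ℤtoℚ m ℚ.*_) (sym (pPow-+ e (- k))) ⟩
      ℤtoℚ m ℚ.* pw (e ℤ.+ - k)      ∎)
      where
      m = proj₁ q∈ℤ[1/p]
      e = proj₁ (proj₂ q∈ℤ[1/p])
      q≡ = proj₂ (proj₂ q∈ℤ[1/p])
    E*p^-k≡p^w : E ℚ.* pw (- k) ≡ pw w
    E*p^-k≡p^w = trans (sym (pPow-+ (w ℤ.+ k) (- k)))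
                       (cong pw (ℤR.solve 2 (λ w k → (w ℤR.:+ k) ℤR.:+ (ℤR.:- k) ℤR.:= w) refl w k))
    CX≡N+s : C ℚ.* X ≡ ℤtoℚ (N ℤ.+ + s)
    CX≡N+s = *-cancelʳ-pos E (pPow-pos (w ℤ.+ k)) (begin
      (C ℚ.* X) ℚ.* E                   ≡⟨ solve 4 (λ c q m e → (c :* (q :* m)) :* e := ((e :* m) :* c) :* q) refl C q (pw (- k)) E ⟩
      ((E ℚ.* pw (- k)) ℚ.* C) ℚ.* q    ≡⟨ cong (λ z → (z ℚ.* C) ℚ.* q) E*p^-k≡p^w ⟩
      (pw w ℚ.* C) ℚ.* q                ≡⟨ solve 2 (λ x y → x := (x :- y) :+ y) refl ((pw w ℚ.* C) ℚ.* q) r ⟩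
      ((pw w ℚ.* C) ℚ.* q ℚ.- r) ℚ.+ r  ≡⟨ cong₂ ℚ._+_ (sym N≡) r≡ ⟩
      E ℚ.* ℤtoℚ N ℚ.+ E ℚ.* ℤtoℚ (+ s) ≡⟨ solve 3 (λ e n s → e :* n :+ e :* s := (n :+ s) :* e) refl E (ℤtoℚ N) (ℤtoℚ (+ s)) ⟩
      (ℤtoℚ N ℚ.+ ℤtoℚ (+ s)) ℚ.* E     ≡⟨ cong (ℚ._* E) (sym (ℤtoℚ-+ N (+ s))) ⟩
      ℤtoℚ (N ℤ.+ + s) ℚ.* E            ∎)
    integral = integral-of-multiple c (N ℤ.+ + s) c>0 p∤c X∈ℤ[1/p] CX≡N+s
    y = proj₁ integral
    X≡y = proj₂ integral
    q≡ : q ≡ pw k ℚ.* ℤtoℚ y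
    q≡ = begin
      q                            ≡⟨ sym (ℚP.*-identityʳ q) ⟩
      q ℚ.* 1ℚ                     ≡⟨ cong (q ℚ.*_) (sym (trans (sym (pPow-+ (- k) k)) (cong pw (ℤP.+-inverseˡ k)))) ⟩
      q ℚ.* (pw (- k) ℚ.* pw k)    ≡⟨ sym (ℚP.*-assoc q (pw (- k)) (pw k)) ⟩
      X ℚ.* pw k                   ≡⟨ cong (ℚ._* pw k) X≡y ⟩
      ℤtoℚ y ℚ.* pw k              ≡⟨ ℚP.*-comm (ℤtoℚ y) (pw k) ⟩
      pw k ℚ.* ℤtoℚ y              ∎
    cy≡N+s : + c ℤ.* y ≡ N ℤ.+ + s
    cy≡N+s = ℤtoℚ-injective (trans (ℤtoℚ-* (+ c) y) (trans (cong (C ℚ.*_) (sym X≡y)) CX≡N+s))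
    euclid : + c ℤ.* y ℤ.- + s ≡ N
    euclid = trans (cong (ℤ._- + s) cy≡N+s) (ℤR.solve 2 (λ n s → (n ℤR.:+ s) ℤR.:- s ℤR.:= n) refl N (+ s))

  -- If the numerator s of the remainder were a nonzero multiple of p, the division
  -- would have a jump: writing N = p^t u (p ∤ u), we get s + u p^t = c y, i.e.
  -- r̄ = s ≡ -u p^(ord N - ord D - k) (mod c), and p ∣ r̄.
  jump-of-rescaled : ∀ k w c N y s → ¬ (p ℕD.∣ c) → N ≢ + 0 → s ℕ.< c → + c ℤ.* y ℤ.- + s ≡ N →
                     s ≢ 0 → p ℕD.∣ s → Jump p pp k (pw w ℚ.* ℤtoℚ (+ c)) (pw (w ℤ.+ k) ℚ.* ℤtoℚ N)
  jump-of-rescaled k w c N y s p∤c N≢0 s<c euclid s≢0 p∣s =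
    w , ℤtoℚ (+ c) , + t ℤ.+ (w ℤ.+ k) , ℤtoℚ u , s , (isPUnit-ℤ (+ c) p∤c , refl) , ord-N ,
    subst (+ s ℤ.<_) (sym (↥-ℤtoℚ (+ c))) (ℤ.+<+ s<c) , congruence , s≢0 , p∣s
    where
    factorisation = ordUnit-ℤ (w ℤ.+ k) N N≢0
    t = proj₁ factorisation
    u = proj₁ (proj₂ factorisation)
    N≡ = proj₁ (proj₂ (proj₂ factorisation))
    ord-N = proj₂ (proj₂ (proj₂ factorisation))
    s+up^t≡yc : + s ℤ.+ u ℤ.* + (p ℕ.^ t) ≡ y ℤ.* + c
    s+up^t≡yc = begin
      + s ℤ.+ u ℤ.* + (p ℕ.^ t)   ≡⟨ cong (λ z → + s ℤ.+ z) (trans (ℤP.*-comm u (+ (p ℕ.^ t))) (sym N≡)) ⟩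
      + s ℤ.+ N                   ≡⟨ cong (λ z → + s ℤ.+ z) (sym euclid) ⟩
      + s ℤ.+ (+ c ℤ.* y ℤ.- + s) ≡⟨ ℤR.solve 3 (λ s c y → s ℤR.:+ (c ℤR.:* y ℤR.:- s) ℤR.:= y ℤR.:* c) refl (+ s) (+ c) y ⟩
      y ℤ.* + c                   ∎
      where open ≡-Reasoning
    exponent : + t ≡ (+ t ℤ.+ (w ℤ.+ k)) ℤ.- w ℤ.- k
    exponent = ℤR.solve 3 (λ t w k → t ℤR.:= (t ℤR.:+ (w ℤR.:+ k)) ℤR.:- w ℤR.:- k) refl (+ t) w k
    congruence : CongrPow p (↥ ℤtoℚ (+ c)) (↥ ℤtoℚ u) ((+ t ℤ.+ (w ℤ.+ k)) ℤ.- w ℤ.- k) s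
    congruence = subst (λ e → CongrPow p (↥ ℤtoℚ (+ c)) (↥ ℤtoℚ u) e s) exponent
                   (subst₂ (λ c' u' → CongrPow p c' u' (+ t) s) (sym (↥-ℤtoℚ (+ c))) (sym (↥-ℤtoℚ u))
                     (ℤS.∣⇒∣ᵤ (ℤS.divides y s+up^t≡yc)))

module Alignment (p : ℕ) (pp : Prime p) (k : ℤ) (α : ℕ) (a b a' b' : ℤ)
  (a≡ : ℤtoℚ a ≡ pPow p pp (+ α) ℚ.* ℤtoℚ a') (0<a' : + 0 ℤ.< a') (p∤a' : ¬ (p ℕD.∣ ∣ a' ∣))
  (b≡ : ℤtoℚ b ≡ pPow p pp (+ α ℤ.+ k) ℚ.* ℤtoℚ b') (0<b' : + 0 ℤ.< b')
  (Q R : ℕ → ℚ) (pkRun : PkGreedyRun p pp k a b Q R) (noJumps : NoJumps p pp k b Q R)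
  (Q' R' : ℕ → ℤ) (fsRun : FSGreedyRun a' b' Q' R')
  where

  private
    pw : ℤ → ℚ
    pw = pPow p pp

  -- W i = ord_p(r_(i-1)) as long as the runs continue.
  W : ℕ → ℤ
  W i = + α ℤ.+ + i ℤ.* k

  W-suc : ∀ i → W (suc i) ≡ W i ℤ.+ k
  W-suc i = trans (cong (λ z → + α ℤ.+ z) (trans (ℤP.suc-* (+ i) k) (ℤP.+-comm k (+ i ℤ.* k))))
                  (sym (ℤP.+-assoc (+ α) (+ i ℤ.* k) k))

  -- The invariant before step i; the product relation is only claimed while the
  -- Fibonacci–Sylvester run has not stopped (afterwards its quotients are arbitrary).
  record Aligned (i : ℕ) : Set where
    field
      remainder≡ : R i ≡ pw (W i) ℚ.* ℤtoℚ (R' i)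
      0≤R'       : + 0 ℤ.≤ R' i
      unit-or-0  : R' i ≡ + 0 ⊎ ¬ (p ℕD.∣ ∣ R' i ∣)
      product≡   : R' i ≢ + 0 → prodℚ Q i ≡ pw (+ i ℤ.* k) ℚ.* ℤtoℚ (prodℤ Q' i)
      0<product  : R' i ≢ + 0 → + 0 ℤ.< prodℤ Q' i

  aligned-start : Aligned 0
  aligned-start = record
    { remainder≡ = trans (proj₁ pkRun) (trans a≡ (cong₂ (λ e x → pw e ℚ.* ℤtoℚ x) (sym W0≡α) (sym (proj₁ fsRun))))
    ; 0≤R'       = subst (+ 0 ℤ.≤_) (sym (proj₁ fsRun)) (ℤP.<⇒≤ 0<a')
    ; unit-or-0  = inj₂ (subst (λ z → ¬ (p ℕD.∣ ∣ z ∣)) (sym (proj₁ fsRun)) p∤a')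
    ; product≡   = λ _ → sym (trans (cong (λ e → pw e ℚ.* 1ℚ) (ℤP.*-zeroˡ k)) (ℚP.*-identityʳ 1ℚ))
    ; 0<product  = λ _ → ℤ.+<+ (ℕ.s≤s ℕ.z≤n)
    }
    where
    W0≡α : W 0 ≡ + α
    W0≡α = trans (cong (λ z → + α ℤ.+ z) (ℤP.*-zeroˡ k)) (ℤP.+-identityʳ (+ α))

  StepResult : ℕ → Set
  StepResult i = (R i ≢ 0ℚ → Q i ≡ pw k ℚ.* ℤtoℚ (Q' i)) × Aligned (suc i)

  zero-scaled : ∀ w {x} → x ≡ + 0 → pw w ℚ.* ℤtoℚ x ≡ 0ℚ
  zero-scaled w refl = ℚP.*-zeroʳ (pw w)

  stopped-step : ∀ i → Aligned i → R' i ≡ + 0 → StepResult i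
  stopped-step i aligned R'≡0 = (λ R≢0 → ⊥-elim (R≢0 R≡0)) , record
    { remainder≡ = trans (proj₂ (proj₂ pkRun i) R≡0) (sym (zero-scaled (W (suc i)) R'-next≡0))
    ; 0≤R'       = ℤP.≤-reflexive (sym R'-next≡0)
    ; unit-or-0  = inj₁ R'-next≡0
    ; product≡   = λ R'≢0 → ⊥-elim (R'≢0 R'-next≡0)
    ; 0<product  = λ R'≢0 → ⊥-elim (R'≢0 R'-next≡0)
    }
    where
    R≡0 : R i ≡ 0ℚ
    R≡0 = trans (Aligned.remainder≡ aligned) (zero-scaled (W i) R'≡0)
    R'-next≡0 : R' (suc i) ≡ + 0
    R'-next≡0 = proj₂ (proj₂ fsRun i) R'≡0

  dividend-rescaled : ∀ i → prodℚ Q i ≡ pw (+ i ℤ.* k) ℚ.* ℤtoℚ (prodℤ Q' i) →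
                      ℤtoℚ b ℚ.* prodℚ Q i ≡ pw (W i ℤ.+ k) ℚ.* ℤtoℚ (b' ℤ.* prodℤ Q' i)
  dividend-rescaled i product≡ = begin
    ℤtoℚ b ℚ.* prodℚ Q i                                        ≡⟨ cong₂ ℚ._*_ b≡ product≡ ⟩
    (pw (+ α ℤ.+ k) ℚ.* ℤtoℚ b') ℚ.* (pw (+ i ℤ.* k) ℚ.* ℤtoℚ P) ≡⟨ *-interchange (pw (+ α ℤ.+ k)) (ℤtoℚ b') (pw (+ i ℤ.* k)) (ℤtoℚ P) ⟩
    (pw (+ α ℤ.+ k) ℚ.* pw (+ i ℤ.* k)) ℚ.* (ℤtoℚ b' ℚ.* ℤtoℚ P) ≡⟨ cong₂ ℚ._*_ (sym (pPow-+ p pp (+ α ℤ.+ k) (+ i ℤ.* k))) (sym (ℤtoℚ-* b' P)) ⟩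
    pw ((+ α ℤ.+ k) ℤ.+ + i ℤ.* k) ℚ.* ℤtoℚ (b' ℤ.* P)            ≡⟨ cong (λ e → pw e ℚ.* ℤtoℚ (b' ℤ.* P)) (ℤR.solve 3 (λ a k ik → (a ℤR.:+ k) ℤR.:+ ik ℤR.:= (a ℤR.:+ ik) ℤR.:+ k) refl (+ α) k (+ i ℤ.* k)) ⟩
    pw (W i ℤ.+ k) ℚ.* ℤtoℚ (b' ℤ.* P)                          ∎
    where
    open ≡-Reasoning
    P = prodℤ Q' i

  product-step : ∀ i → prodℚ Q i ≡ pw (+ i ℤ.* k) ℚ.* ℤtoℚ (prodℤ Q' i) → Q i ≡ pw k ℚ.* ℤtoℚ (Q' i) →
                 prodℚ Q (suc i) ≡ pw (+ suc i ℤ.* k) ℚ.* ℤtoℚ (prodℤ Q' (suc i))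
  product-step i product≡ Q≡ = begin
    prodℚ Q i ℚ.* Q i                                       ≡⟨ cong₂ ℚ._*_ product≡ Q≡ ⟩
    (pw (+ i ℤ.* k) ℚ.* ℤtoℚ P) ℚ.* (pw k ℚ.* ℤtoℚ (Q' i))   ≡⟨ *-interchange (pw (+ i ℤ.* k)) (ℤtoℚ P) (pw k) (ℤtoℚ (Q' i)) ⟩
    (pw (+ i ℤ.* k) ℚ.* pw k) ℚ.* (ℤtoℚ P ℚ.* ℤtoℚ (Q' i))   ≡⟨ cong₂ ℚ._*_ (sym (pPow-+ p pp (+ i ℤ.* k) k)) (sym (ℤtoℚ-* P (Q' i))) ⟩
    pw (+ i ℤ.* k ℤ.+ k) ℚ.* ℤtoℚ (P ℤ.* Q' i)               ≡⟨ cong (λ e → pw e ℚ.* ℤtoℚ (P ℤ.* Q' i)) (sym (trans (ℤP.suc-* (+ i) k) (ℤP.+-comm k (+ i ℤ.* k)))) ⟩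
    pw (+ suc i ℤ.* k) ℚ.* ℤtoℚ (P ℤ.* Q' i)                 ∎
    where
    open ≡-Reasoning
    P = prodℤ Q' i

  -- While r'_(i-1) = c ≠ 0, step i of the p^k-Greedy Algorithm is the Fibonacci–Sylvester
  -- step rescaled: its divisor is p^(W i) c and its dividend p^(W i + k) N with
  -- N = b' q'_0⋯q'_(i-1), so pkDivision-rescaled and euclid-unique identify the two.
  active-step : ∀ i → Aligned i → R' i ≢ + 0 → StepResult i
  active-step i aligned R'≢0 =
    compare-with-FS (pkDivision-rescaled p pp k (W i) c N 0<c p∤c
      (subst₂ (λ D B → PkDivision p pp k D B (Q i) (R (suc i))) R≡ dividend≡ (proj₁ (proj₂ pkRun i) R≢0)))
    where
    open Aligned aligned
    open ≡-Reasoning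
    c = ∣ R' i ∣
    R'≡c : R' i ≡ + c
    R'≡c = sym (ℤP.0≤i⇒+∣i∣≡i 0≤R')
    0<c : 0 ℕ.< c
    0<c = ℕP.n≢0⇒n>0 (λ c≡0 → R'≢0 (trans R'≡c (cong +_ c≡0)))
    p∤c : ¬ (p ℕD.∣ c)
    p∤c = [ (λ R'≡0 → ⊥-elim (R'≢0 R'≡0)) , (λ p∤R' → p∤R') ]′ unit-or-0
    C = ℤtoℚ (+ c)
    R≡ : R i ≡ pw (W i) ℚ.* C
    R≡ = trans remainder≡ (cong (λ x → pw (W i) ℚ.* ℤtoℚ x) R'≡c)
    R≢0 : R i ≢ 0ℚ
    R≢0 R≡0 = ℚP.<-irrefl (trans (sym R≡0) R≡) (ℚP.positive⁻¹ _ {{ℚP.pos*pos⇒pos (pw (W i)) C}})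
      where instance
        _ = ℚ.positive (pPow-pos p pp (W i))
        _ = ℚ.positive (ℤtoℚ-mono-< (ℤ.+<+ 0<c))
    P = prodℤ Q' i
    0<P = 0<product R'≢0
    N = b' ℤ.* P
    0<N : + 0 ℤ.< N
    0<N = *-pos 0<b' 0<P
    N≢0 : N ≢ + 0
    N≢0 N≡0 = ℤP.<-irrefl (sym N≡0) 0<N
    dividend≡ : ℤtoℚ b ℚ.* prodℚ Q i ≡ pw (W i ℤ.+ k) ℚ.* ℤtoℚ N
    dividend≡ = dividend-rescaled i (product≡ R'≢0)
    fsStep = proj₁ (proj₂ fsRun i) R'≢0
    r' = R' (suc i)
    N≡cQ'-r' : N ≡ + c ℤ.* Q' i ℤ.- r'
    N≡cQ'-r' = trans (proj₁ fsStep) (cong (λ x → x ℤ.* Q' i ℤ.- r') R'≡c)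
    0≤r' = proj₁ (proj₂ fsStep)
    r'<c : r' ℤ.< + c
    r'<c = subst (r' ℤ.<_) R'≡c (proj₂ (proj₂ fsStep))
    -- c q'_i = N + r'_i ≥ N > 0
    0<Q' : + 0 ℤ.< Q' i
    0<Q' = ℤP.*-cancelˡ-<-nonNeg (+ c) (subst₂ ℤ._<_ (sym (ℤP.*-zeroʳ (+ c))) (sym cQ'≡N+r')
                                          (ℤP.<-≤-trans 0<N (ℤP.i≤i+j N r' {{ℤ.nonNegative 0≤r'}})))
      where
      cQ'≡N+r' : + c ℤ.* Q' i ≡ N ℤ.+ r'
      cQ'≡N+r' = trans (ℤR.solve 2 (λ a r → a ℤR.:= (a ℤR.:- r) ℤR.:+ r) refl (+ c ℤ.* Q' i) r') (cong (ℤ._+ r') (sym N≡cQ'-r'))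
    compare-with-FS : RescaledEuclid p pp k (W i) c N (Q i) (R (suc i)) → StepResult i
    compare-with-FS division = (λ _ → Q≡) , record
      { remainder≡ = trans r≡p^wk·s (cong₂ (λ e x → pw e ℚ.* ℤtoℚ x) (sym (W-suc i)) s≡r')
      ; 0≤R'       = 0≤r'
      ; unit-or-0  = r'-unit-or-0
      ; product≡   = λ _ → product-step i (product≡ R'≢0) Q≡
      ; 0<product  = λ _ → *-pos 0<P 0<Q'
      }
      where
      open RescaledEuclid division
      y≡Q' : y ≡ Q' i
      y≡Q' = euclid-unique (ℤ.+<+ 0<c) (trans N≡cy-s N≡cQ'-r') (ℤ.+≤+ ℕ.z≤n) (ℤ.+<+ s<c) 0≤r' r'<c
      s≡r' : + s ≡ r'
      s≡r' = begin
        + s                                     ≡⟨ ℤR.solve 2 (λ a s → s ℤR.:= a ℤR.:- (a ℤR.:- s)) refl (+ c ℤ.* y) (+ s) ⟩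
        + c ℤ.* y ℤ.- (+ c ℤ.* y ℤ.- + s)       ≡⟨ cong₂ ℤ._-_ (cong (+ c ℤ.*_) y≡Q') (trans N≡cy-s N≡cQ'-r') ⟩
        + c ℤ.* Q' i ℤ.- (+ c ℤ.* Q' i ℤ.- r')  ≡⟨ ℤR.solve 2 (λ a r → a ℤR.:- (a ℤR.:- r) ℤR.:= r) refl (+ c ℤ.* Q' i) r' ⟩
        r'                                      ∎
      Q≡ : Q i ≡ pw k ℚ.* ℤtoℚ (Q' i)
      Q≡ = trans q≡p^k·y (cong (λ z → pw k ℚ.* ℤtoℚ z) y≡Q')
      -- no jump occurs in step i, so a nonzero s is prime to p
      r'-unit-or-0 : r' ≡ + 0 ⊎ ¬ (p ℕD.∣ ∣ r' ∣)
      r'-unit-or-0 = [ (λ s≡0 → inj₁ (trans (sym s≡r') (cong +_ s≡0))) ,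
                       [ (λ p∤s → inj₂ (subst (λ z → ¬ (p ℕD.∣ ∣ z ∣)) s≡r' p∤s)) ,
                         (λ { (s≢0 , p∣s) → ⊥-elim (noJumps i R≢0 (subst₂ (Jump p pp k) (sym R≡) (sym dividend≡)
                                (jump-of-rescaled p pp k (W i) c N y s p∤c N≢0 s<c N≡cy-s s≢0 p∣s))) }) ]′ ]′
                     (zero-unit-or-multiple p pp s)

  aligned-step : ∀ i → Aligned i → StepResult i
  aligned-step i aligned with R' i ℤP.≟ + 0
  ... | yes R'≡0 = stopped-step i aligned R'≡0
  ... | no  R'≢0 = active-step i aligned R'≢0

  aligned : ∀ i → Aligned i
  aligned zero    = aligned-start
  aligned (suc i) = proj₂ (aligned-step i (aligned i))

  runs-correspond : ∀ i → ((R i ≡ 0ℚ → R' i ≡ + 0) × (R' i ≡ + 0 → R i ≡ 0ℚ))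
                        × (R i ≢ 0ℚ → Q i ≡ pw k ℚ.* ℤtoℚ (Q' i))
  runs-correspond i = (R≡0⇒R'≡0 , λ R'≡0 → trans R≡ (zero-scaled (W i) R'≡0)) , proj₁ (aligned-step i (aligned i))
    where
    R≡ = Aligned.remainder≡ (aligned i)
    R≡0⇒R'≡0 : R i ≡ 0ℚ → R' i ≡ + 0
    R≡0⇒R'≡0 R≡0 = ℤtoℚ-injective (*-cancelʳ-pos (pw (W i)) (pPow-pos p pp (W i))
      (trans (ℚP.*-comm (ℤtoℚ (R' i)) (pw (W i))) (trans (sym R≡) (trans R≡0 (sym (ℚP.*-zeroˡ (pw (W i))))))))

module _ (p : ℕ) (pp : Prime p) where
  private
    pw : ℤ → ℚ
    pw = pPow p pp

  p-factor-pos : ∀ a → + 0 ℤ.< a → Σ ℕ λ α → Σ ℕ λ â →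
                 ∣ a ∣ ≡ p ℕ.^ α ℕ.* â × ¬ (p ℕD.∣ â) × ℤtoℚ a ≡ pw (+ α) ℚ.* ℤtoℚ (+ â)
  p-factor-pos a 0<a = α , â , ∣a∣≡ , p∤â , a≡
    where
    a≡∣a∣ : a ≡ + ∣ a ∣
    a≡∣a∣ = sym (ℤP.0≤i⇒+∣i∣≡i (ℤP.<⇒≤ 0<a))
    factorisation = p-factorℕ p pp ∣ a ∣ (λ ∣a∣≡0 → ℤP.<-irrefl (sym (trans a≡∣a∣ (cong +_ ∣a∣≡0))) 0<a)
    α = proj₁ factorisation
    â = proj₁ (proj₂ factorisation)
    ∣a∣≡ = proj₁ (proj₂ (proj₂ factorisation))
    p∤â = proj₂ (proj₂ (proj₂ factorisation))
    a≡ : ℤtoℚ a ≡ pw (+ α) ℚ.* ℤtoℚ (+ â)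
    a≡ = trans (cong ℤtoℚ (trans a≡∣a∣ (trans (cong +_ ∣a∣≡) (ℤP.pos-* (p ℕ.^ α) â)))) (ℤtoℚ-* (+ (p ℕ.^ α)) (+ â))

  ord-of-ratio : ∀ {a b} α β â b̂ → Coprime â b̂ → ¬ (p ℕD.∣ â) → ¬ (p ℕD.∣ b̂) → b̂ ≢ 0 →
                 ℤtoℚ a ≡ pw (+ α) ℚ.* ℤtoℚ (+ â) → ℤtoℚ b ≡ pw (+ β) ℚ.* ℤtoℚ (+ b̂) →
                 Σ ℚ λ x → x ℚ.* ℤtoℚ b ≡ ℤtoℚ a × Ord p pp x (+ α ℤ.- + β)
  ord-of-ratio α β â zero    _   _   _   b̂≢0 _  _  = ⊥-elim (b̂≢0 refl)
  ord-of-ratio {a} {b} α β â (suc d) cop p∤â p∤b̂ _ a≡ b≡ = x , x*b≡a , u , (p∤â , p∤b̂) , refl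
    where
    open ≡-Reasoning
    u = mkℚ (+ â) d cop
    e = + α ℤ.- + β
    x = pw e ℚ.* u
    x*b≡a : x ℚ.* ℤtoℚ b ≡ ℤtoℚ a
    x*b≡a = begin
      x ℚ.* ℤtoℚ b                                     ≡⟨ cong (x ℚ.*_) b≡ ⟩
      (pw e ℚ.* u) ℚ.* (pw (+ β) ℚ.* ℤtoℚ (+ suc d))   ≡⟨ *-interchange (pw e) u (pw (+ β)) (ℤtoℚ (+ suc d)) ⟩
      (pw e ℚ.* pw (+ β)) ℚ.* (u ℚ.* ℤtoℚ (+ suc d))   ≡⟨ cong₂ ℚ._*_ (sym (pPow-+ p pp e (+ β))) (mkℚ-*-denominator (+ â) d cop) ⟩
      pw (e ℤ.+ + β) ℚ.* ℤtoℚ (+ â)                    ≡⟨ cong (λ z → pw z ℚ.* ℤtoℚ (+ â)) (ℤR.solve 2 (λ a b → (a ℤR.:- b) ℤR.:+ b ℤR.:= a) refl (+ α) (+ β)) ⟩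
      pw (+ α) ℚ.* ℤtoℚ (+ â)                          ≡⟨ sym a≡ ⟩
      ℤtoℚ a                                           ∎

  -- If a'/b' is in lowest terms and a' (b̂ p^n) = b' â with gcd(â, b̂) = 1 and p ∤ â,
  -- then a' = â: each of a', â divides the other.
  lowest-terms-numerator : ∀ {a' b' â b̂} n → Coprime a' b' → Coprime â b̂ → ¬ (p ℕD.∣ â) →
                           a' ℕ.* (b̂ ℕ.* p ℕ.^ n) ≡ b' ℕ.* â → a' ≡ â
  lowest-terms-numerator {a'} {b'} {â} {b̂} n cop' cop p∤â eq = ℕD.∣-antisym a'∣â â∣a'
    where
    a'∣â : a' ℕD.∣ â
    a'∣â = Cop.coprime-divisor cop' (divides (b̂ ℕ.* p ℕ.^ n) (trans (sym eq) (ℕP.*-comm a' (b̂ ℕ.* p ℕ.^ n))))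
    p^n[b̂a']≡a'[b̂p^n] : p ℕ.^ n ℕ.* (b̂ ℕ.* a') ≡ a' ℕ.* (b̂ ℕ.* p ℕ.^ n)
    p^n[b̂a']≡a'[b̂p^n] = trans (sym (ℕP.*-assoc (p ℕ.^ n) b̂ a'))
      (trans (ℕP.*-comm (p ℕ.^ n ℕ.* b̂) a') (cong (a' ℕ.*_) (ℕP.*-comm (p ℕ.^ n) b̂)))
    â∣a' : â ℕD.∣ a'
    â∣a' = Cop.coprime-divisor cop (cancel-p^ p pp n p∤â (divides b' (trans p^n[b̂a']≡a'[b̂p^n] eq)))

  cross-equation : ∀ {a b a' b' X} α k â → ℤtoℚ a ≡ pw (+ α) ℚ.* ℤtoℚ (+ â) →
                   ℤtoℚ b ≡ pw (+ α ℤ.+ k) ℚ.* ℤtoℚ X →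
                   ℤtoℚ a' ℚ.* ℤtoℚ b ≡ ℤtoℚ b' ℚ.* (ℤtoℚ a ℚ.* pw k) → a' ℤ.* X ≡ b' ℤ.* + â
  cross-equation {a} {b} {a'} {b'} {X} α k â a≡ b≡ a'b≡b'ap^k =
    ℤtoℚ-injective (*-cancelʳ-pos F (pPow-pos p pp (+ α ℤ.+ k)) (begin
      ℤtoℚ (a' ℤ.* X) ℚ.* F                           ≡⟨ cong (ℚ._* F) (ℤtoℚ-* a' X) ⟩
      (ℤtoℚ a' ℚ.* ℤtoℚ X) ℚ.* F                      ≡⟨ solve 3 (λ a x f → (a :* x) :* f := a :* (f :* x)) refl (ℤtoℚ a') (ℤtoℚ X) F ⟩
      ℤtoℚ a' ℚ.* (F ℚ.* ℤtoℚ X)                      ≡⟨ cong (ℤtoℚ a' ℚ.*_) (sym b≡) ⟩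
      ℤtoℚ a' ℚ.* ℤtoℚ b                              ≡⟨ a'b≡b'ap^k ⟩
      ℤtoℚ b' ℚ.* (ℤtoℚ a ℚ.* pw k)                   ≡⟨ cong (λ z → ℤtoℚ b' ℚ.* (z ℚ.* pw k)) a≡ ⟩
      ℤtoℚ b' ℚ.* ((pw (+ α) ℚ.* Â) ℚ.* pw k)         ≡⟨ solve 4 (λ b a h k → b :* ((a :* h) :* k) := (b :* h) :* (a :* k)) refl (ℤtoℚ b') (pw (+ α)) Â (pw k) ⟩
      (ℤtoℚ b' ℚ.* Â) ℚ.* (pw (+ α) ℚ.* pw k)         ≡⟨ cong₂ ℚ._*_ (sym (ℤtoℚ-* b' (+ â))) (sym (pPow-+ p pp (+ α) k)) ⟩
      ℤtoℚ (b' ℤ.* + â) ℚ.* F                         ∎))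
    where
    open ≡-Reasoning
    F = pw (+ α ℤ.+ k)
    Â = ℤtoℚ (+ â)

  record NormalForm (k a b a' b' : ℤ) : Set where
    field
      α    : ℕ
      a≡   : ℤtoℚ a ≡ pw (+ α) ℚ.* ℤtoℚ a'
      p∤a' : ¬ (p ℕD.∣ ∣ a' ∣)
      b≡   : ℤtoℚ b ≡ pw (+ α ℤ.+ k) ℚ.* ℤtoℚ b'
      0<b' : + 0 ℤ.< b'

  -- Write a = p^α â, b = p^β b̂.  The hypothesis on k gives β = α + k + n with n ≥ 0,
  -- so a p^k / b = â / (b̂ p^n); comparing lowest terms, a' = â and b' = b̂ p^n.
  normal-form : ∀ a b → + 0 ℤ.< a → + 0 ℤ.< b → gcd a b ≡ + 1 → ∀ k →
                (∀ (x : ℚ) → x ℚ.* ℤtoℚ b ≡ ℤtoℚ a → ∀ v → Ord p pp x v → k ℤ.≤ - v) →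
                ∀ a' b' → + 0 ℤ.< a' → gcd a' b' ≡ + 1 →
                ℤtoℚ a' ℚ.* ℤtoℚ b ≡ ℤtoℚ b' ℚ.* (ℤtoℚ a ℚ.* pw k) → NormalForm k a b a' b'
  normal-form a b 0<a 0<b gcd[a,b]≡1 k k≤-ord a' b' 0<a' gcd[a',b']≡1 a'b≡b'ap^k = record
    { α = α ; a≡ = subst (λ z → ℤtoℚ a ≡ pw (+ α) ℚ.* ℤtoℚ z) (sym a'≡â) a≡ ; p∤a' = subst (λ z → ¬ (p ℕD.∣ z)) (sym ∣a'∣≡â) p∤â
    ; b≡ = subst (λ z → ℤtoℚ b ≡ pw (+ α ℤ.+ k) ℚ.* ℤtoℚ z) (sym b'≡X) b≡ ; 0<b' = subst (+ 0 ℤ.<_) (sym b'≡X) 0<X }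
    where
    open ≡-Reasoning
    fa = p-factor-pos a 0<a
    α = proj₁ fa
    â = proj₁ (proj₂ fa)
    ∣a∣≡ = proj₁ (proj₂ (proj₂ fa))
    p∤â = proj₁ (proj₂ (proj₂ (proj₂ fa)))
    a≡ = proj₂ (proj₂ (proj₂ (proj₂ fa)))
    fb = p-factor-pos b 0<b
    β = proj₁ fb
    b̂ = proj₁ (proj₂ fb)
    ∣b∣≡ = proj₁ (proj₂ (proj₂ fb))
    p∤b̂ = proj₁ (proj₂ (proj₂ (proj₂ fb)))
    b≡p^β·b̂ = proj₂ (proj₂ (proj₂ (proj₂ fb)))
    coprime-âb̂ : Coprime â b̂
    coprime-âb̂ (d∣â , d∣b̂) = Cop.gcd≡1⇒coprime (ℤP.+-injective gcd[a,b]≡1)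
      (ℕD.∣-trans d∣â (divides (p ℕ.^ α) ∣a∣≡) , ℕD.∣-trans d∣b̂ (divides (p ℕ.^ β) ∣b∣≡))
    nonzero-factor : ∀ {m} j u → 0 ℕ.< ∣ m ∣ → ∣ m ∣ ≡ p ℕ.^ j ℕ.* u → u ≢ 0
    nonzero-factor j u 0<∣m∣ ∣m∣≡ refl = ℕP.<⇒≢ 0<∣m∣ (sym (trans ∣m∣≡ (ℕP.*-zeroʳ (p ℕ.^ j))))
    â≢0 : â ≢ 0
    â≢0 = nonzero-factor {a} α â (ℤP.drop‿+<+ (subst (+ 0 ℤ.<_) (sym (ℤP.0≤i⇒+∣i∣≡i (ℤP.<⇒≤ 0<a))) 0<a)) ∣a∣≡
    b̂≢0 : b̂ ≢ 0
    b̂≢0 = nonzero-factor {b} β b̂ (ℤP.drop‿+<+ (subst (+ 0 ℤ.<_) (sym (ℤP.0≤i⇒+∣i∣≡i (ℤP.<⇒≤ 0<b))) 0<b)) ∣b∣≡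
    -- k ≤ -ord_p(a/b) = β - α, so β = (α + k) + n for a natural n
    ratio = ord-of-ratio {a} {b} α β â b̂ coprime-âb̂ p∤â p∤b̂ b̂≢0 a≡ b≡p^β·b̂
    k≤β-α : k ℤ.≤ - (+ α ℤ.- + β)
    k≤β-α = k≤-ord (proj₁ ratio) (proj₁ (proj₂ ratio)) (+ α ℤ.- + β) (proj₂ (proj₂ ratio))
    n = ∣ - (+ α ℤ.- + β) ℤ.- k ∣
    β≡α+k+n : + β ≡ (+ α ℤ.+ k) ℤ.+ + n
    β≡α+k+n = trans (ℤR.solve 3 (λ a b k → b ℤR.:= (a ℤR.:+ k) ℤR.:+ ((ℤR.:- (a ℤR.:- b)) ℤR.:- k)) refl (+ α) (+ β) k)
                    (cong (λ z → (+ α ℤ.+ k) ℤ.+ z) (sym (ℤP.0≤i⇒+∣i∣≡i (ℤP.i≤j⇒0≤j-i k≤β-α))))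
    X = + (b̂ ℕ.* p ℕ.^ n)
    0<X : + 0 ℤ.< X
    0<X = ℤ.+<+ (ℕP.*-mono-< (ℕP.n≢0⇒n>0 b̂≢0) (p^n>0 p pp n))
    b≡ : ℤtoℚ b ≡ pw (+ α ℤ.+ k) ℚ.* ℤtoℚ X
    b≡ = begin
      ℤtoℚ b                                             ≡⟨ b≡p^β·b̂ ⟩
      pw (+ β) ℚ.* ℤtoℚ (+ b̂)                            ≡⟨ cong (λ e → pw e ℚ.* ℤtoℚ (+ b̂)) β≡α+k+n ⟩
      pw ((+ α ℤ.+ k) ℤ.+ + n) ℚ.* ℤtoℚ (+ b̂)             ≡⟨ cong (ℚ._* ℤtoℚ (+ b̂)) (pPow-+ p pp (+ α ℤ.+ k) (+ n)) ⟩
      (pw (+ α ℤ.+ k) ℚ.* pw (+ n)) ℚ.* ℤtoℚ (+ b̂)       ≡⟨ solve 3 (λ f q b → (f :* q) :* b := f :* (b :* q)) refl (pw (+ α ℤ.+ k)) (pw (+ n)) (ℤtoℚ (+ b̂)) ⟩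
      pw (+ α ℤ.+ k) ℚ.* (ℤtoℚ (+ b̂) ℚ.* pw (+ n))       ≡⟨ cong (pw (+ α ℤ.+ k) ℚ.*_) (sym (trans (cong ℤtoℚ (ℤP.pos-* b̂ (p ℕ.^ n))) (ℤtoℚ-* (+ b̂) (+ (p ℕ.^ n))))) ⟩
      pw (+ α ℤ.+ k) ℚ.* ℤtoℚ X                          ∎
    a'X≡b'â : a' ℤ.* X ≡ b' ℤ.* + â
    a'X≡b'â = cross-equation {a} {b} {a'} {b'} {X} α k â a≡ b≡ a'b≡b'ap^k
    ∣a'∣≡â : ∣ a' ∣ ≡ â
    ∣a'∣≡â = lowest-terms-numerator n (Cop.gcd≡1⇒coprime (ℤP.+-injective gcd[a',b']≡1)) coprime-âb̂ p∤â
               (trans (sym (ℤP.abs-* a' X)) (trans (cong ∣_∣ a'X≡b'â) (ℤP.abs-* b' (+ â))))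
    a'≡â : a' ≡ + â
    a'≡â = trans (sym (ℤP.0≤i⇒+∣i∣≡i (ℤP.<⇒≤ 0<a'))) (cong +_ ∣a'∣≡â)
    b'≡X : b' ≡ X
    b'≡X = sym (ℤP.*-cancelˡ-≡ (+ â) X b' {{ℕ.≢-nonZero â≢0}}
             (trans (cong (ℤ._* X) (sym a'≡â)) (trans a'X≡b'â (ℤP.*-comm b' (+ â)))))

corollary4p6 : (p : ℕ) (pp : Prime p) (a b : ℤ) → + 0 ℤ.< a → + 0 ℤ.< b → gcd a b ≡ + 1 →
    (k : ℤ) →
    (∀ (x : ℚ) → x ℚ.* ℤtoℚ b ≡ ℤtoℚ a → ∀ v → Ord p pp x v → k ℤ.≤ - v) →
    (Q R : ℕ → ℚ) → PkGreedyRun p pp k a b Q R → NoJumps p pp k b Q R →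
    (a' b' : ℤ) → + 0 ℤ.< a' → gcd a' b' ≡ + 1 →
    ℤtoℚ a' ℚ.* ℤtoℚ b ≡ ℤtoℚ b' ℚ.* (ℤtoℚ a ℚ.* pPow p pp k) →
    (Q' R' : ℕ → ℤ) → FSGreedyRun a' b' Q' R' →
    ∀ i → ((R i ≡ 0ℚ → R' i ≡ + 0) × (R' i ≡ + 0 → R i ≡ 0ℚ))
        × (R i ≢ 0ℚ → Q i ≡ pPow p pp k ℚ.* ℤtoℚ (Q' i))
corollary4p6 p pp a b 0<a 0<b gcd[a,b]≡1 k k≤-ord Q R pkRun noJumps a' b' 0<a' gcd[a',b']≡1 a'b≡b'ap^k Q' R' fsRun =
  Alignment.runs-correspond p pp k α a b a' b' a≡ 0<a' p∤a' b≡ 0<b' Q R pkRun noJumps Q' R' fsRun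
  where
  open NormalForm (normal-form p pp a b 0<a 0<b gcd[a,b]≡1 k k≤-ord a' b' 0<a' gcd[a',b']≡1 a'b≡b'ap^k)
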